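{- For all integers $k\geq 2$ and $n\geq 2$, the DCell network $D_{k,n}$ is super-$\lambda$, i.e. every minimum edge-cut of $D_{k,n}$ consists of the set of edges incident to a single vertex.
   Context: DCell $D_{k,n}$ ($n\geq 2$, $k\geq 0$) is defined recursively. $D_{0,n}$ is the complete graph $K_n$ on vertices $0,1,\dots,n-1$. Let $t_{k,n}=|V(D_{k,n})|$. For $k\geq1$, $D_{k,n}$ is built from $t_{k-1,n}+1$ disjoint copies $D^0_{k-1,n},\dots,D^{t_{k-1,n}}_{k-1,n}$ of $D_{k-1,n}$; a vertex of copy $D^i_{k-1,n}$ is labeled $(i,a_{k-1},\dots,a_0)$, where $(a_{k-1},\dots,a_0)$ is its label in $D_{k-1,n}$ (with $a_0\in\{0,\dots,n-1\}$), and its index within the copy is $uid_{k-1}=a_0+\sum_{l=1}^{k-1}a_l t_{l-1,n}$. For each pair $a<b$ of copy indices, one new edge (a level $k$ edge) joins the vertex of $D^a_{k-1,n}$ with $uid_{k-1}=b-1$ to the vertex of $D^b_{k-1,n}$ with $uid_{k-1}=a$. Edges of the base copies of $K_n$ are level $0$ edges; edges added at step $j$ are level $j$ edges. $D_{k,n}$ is $(n+k-1)$-regular. A graph is super-$\lambda$ if every minimum edge-cut isolates a single vertex. -}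

module Defs where

open import Data.Nat using (ℕ; zero; suc; _+_; _*_; _∸_; _≤_; _<ᵇ_; _≡ᵇ_)
open import Data.Nat.DivMod using (_/_; _%_)
open import Data.Bool using (Bool; true; false; if_then_else_; _∧_; _∨_; not; T)
open import Data.Fin using (Fin; toℕ)
open import Data.List using (List; map; allFin)
open import Data.Nat.ListAction using (sum)
open import Data.Product using (Σ; ∃; _×_)
open import Relation.Binary.PropositionalEquality using (_≡_)
open import Relation.Nullary using (¬_)

-- t n k = |V(D_{k,n})| :  t_{0,n} = n,  t_{k,n} = t_{k-1,n} (t_{k-1,n} + 1)
t : ℕ → ℕ → ℕ
t n zero    = n
t n (suc k) = t n k * (t n k + 1)

-- total division / modulus (divisor 0 never occurs for n ≥ 1)
div' : ℕ → ℕ → ℕ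
div' u zero    = 0
div' u (suc s) = u / suc s

mod' : ℕ → ℕ → ℕ
mod' u zero    = u
mod' u (suc s) = u % suc s

-- Vertices of D_{k,n} are identified with their uid_k ∈ {0,…,t_{k,n}-1}.
-- Vertex (i, a_{k-1},…,a_0) of D_{k,n} has uid_k = i * t_{k-1,n} + uid_{k-1},
-- so copy index i = uid / t_{k-1,n}, inner uid = uid % t_{k-1,n}.
-- adj n k u v : u,v adjacent in D_{k,n}.
adj : ℕ → ℕ → ℕ → ℕ → Bool
adj n zero    u v = not (u ≡ᵇ v)
adj n (suc k) u v =
  let s = t n k
      i = div' u s ; a = mod' u s
      j = div' v s ; b = mod' v s
  in if i ≡ᵇ j then adj n k a b
     else if i <ᵇ j then ((a ≡ᵇ j ∸ 1) ∧ (b ≡ᵇ i))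
     else ((b ≡ᵇ i ∸ 1) ∧ (a ≡ᵇ j))

V : ℕ → ℕ → Set
V n k = Fin (t n k)

Adj : (n k : ℕ) → V n k → V n k → Bool
Adj n k x y = adj n k (toℕ x) (toℕ y)

EdgeSet : ℕ → ℕ → Set
EdgeSet n k = V n k → V n k → Bool

IsEdgeSubset : (n k : ℕ) → EdgeSet n k → Set
IsEdgeSubset n k F =
  (∀ x y → F x y ≡ F y x) × (∀ x y → T (F x y) → T (Adj n k x y))

-- number of edges in F (each unordered edge {x,y} counted once via toℕ x < toℕ y)
size : (n k : ℕ) → EdgeSet n k → ℕ
size n k F =
  sum (map (λ x → sum (map (λ y →
        if (toℕ x <ᵇ toℕ y) ∧ F x y then 1 else 0) (allFin (t n k)))) (allFin (t n k)))

data Reach (n k : ℕ) (F : EdgeSet n k) (x : V n k) : V n k → Set where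
  here : Reach n k F x x
  step : ∀ {w y} → Reach n k F x w → T (Adj n k w y) → F w y ≡ false → Reach n k F x y

IsEdgeCut : (n k : ℕ) → EdgeSet n k → Set
IsEdgeCut n k F = IsEdgeSubset n k F × ∃ λ x → ∃ λ y → ¬ Reach n k F x y

IsMinEdgeCut : (n k : ℕ) → EdgeSet n k → Set
IsMinEdgeCut n k F =
  IsEdgeCut n k F × (∀ F′ → IsEdgeCut n k F′ → size n k F ≤ size n k F′)

SuperLambda : (n k : ℕ) → Set
SuperLambda n k =
  ∀ F → IsMinEdgeCut n k F →
    ∃ λ (v : V n k) → ∀ x y →
      F x y ≡ (Adj n k x y ∧ ((toℕ x ≡ᵇ toℕ v) ∨ (toℕ y ≡ᵇ toℕ v)))

-- The edge connectivity λ(D_{k,n}) ≥ n + k − 1 is proved by induction on k. An edge cut F of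
-- D_{k+1,n} splits into its edges inside the t_{k,n} + 1 copies of D_{k,n} and its level edges,
-- which form an edge set of the complete graph on the copies. If no copy is heavy (carries at
-- least n + k − 1 edges of F), all copies stay connected, so F must separate the complete graph on
-- the copies, which costs t_{k,n} ≥ n + k edges. If some copy is heavy, F has no edge left outside
-- it: the other copies stay connected and joined to each other, and every vertex of the heavy copy
-- escapes it through its level edge.
--
-- For k ≥ 2 a minimum cut has at most n + k − 1 edges, the degree. The same dichotomy, now with
-- room for one more edge, shows that one of two separated vertices has all its edges in F: a
-- vertex of the heavy copy with an edge outside F escapes it, since it and that neighbour would
-- otherwise need two cut level edges. The star of this vertex is itself a cut, so by minimality F
-- is that star.

module Submission where

open import Defs

open import Data.Bool using (Bool; true; false; if_then_else_; _∧_; _∨_; not; T; T?)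
open import Data.Bool.Properties using (∧-comm; ∧-zeroʳ; ∨-comm; T-∧; T-≡)
import Data.Bool.Properties as Bool
open import Data.Empty using (⊥; ⊥-elim)
open import Data.Fin using (Fin; toℕ; fromℕ<) renaming (zero to fzero; suc to fsuc)
open import Data.Fin.Properties using (toℕ-fromℕ<; toℕ-injective; toℕ<n)
open import Data.List using (map; allFin; tabulate)
open import Data.List.Properties using (map-tabulate)
open import Data.Maybe using (Maybe; just; nothing; maybe)
import Data.Maybe as Maybe
open import Data.Nat using (ℕ; zero; suc; _+_; _*_; _∸_; _≤_; _<_; _≤?_; _<ᵇ_; _≡ᵇ_; z≤n; s≤s; z<s; s<s)
open import Data.Nat.DivMod
open import Data.Nat.Divisibility using (divides-refl)
open import Data.Nat.ListAction using (sum)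
open import Data.Nat.Properties
open import Algebra.Properties.CommutativeSemigroup +-commutativeSemigroup using (interchange; xy∙z≈xz∙y; x∙yz≈yx∙z)
open import Data.Product using (Σ; ∃; _×_; _,_; proj₁; proj₂)
open import Data.Sum using (_⊎_; inj₁; inj₂)
open import Data.Unit using (tt)
open import Effect.Monad using (RawMonad)
open import Function using (id; _∘_)
open import Function.Bundles using (Equivalence)
open import Level using (0ℓ)
open import Relation.Binary using (tri<; tri≈; tri>)
open import Relation.Binary.PropositionalEquality
open import Relation.Nullary using (¬_; Dec; yes; no)
open import Relation.Nullary.Decidable using (_×-dec_)
open import Relation.Nullary.Negation using (¬¬-Monad)

𝟙 : Bool → ℕ
𝟙 b = if b then 1 else 0

𝟙≤1 : ∀ b → 𝟙 b ≤ 1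
𝟙≤1 true  = ≤-refl
𝟙≤1 false = z≤n

𝟙-true : ∀ {b} → T b → 𝟙 b ≡ 1
𝟙-true {true} _ = refl

𝟙-mono : ∀ {a b} → (T a → T b) → 𝟙 a ≤ 𝟙 b
𝟙-mono {false}         _ = z≤n
𝟙-mono {true} {true}  _ = ≤-refl
𝟙-mono {true} {false} f = ⊥-elim (f tt)

𝟙-∧≤ˡ : ∀ a b → 𝟙 (a ∧ b) ≤ 𝟙 a
𝟙-∧≤ˡ true  b = 𝟙≤1 b
𝟙-∧≤ˡ false b = z≤n

𝟙-∨ : ∀ a b → T (a ∨ b) → 1 ≤ 𝟙 a + 𝟙 b
𝟙-∨ true  b     _ = s≤s z≤n
𝟙-∨ false true  _ = s≤s z≤n

T⇒≡true : ∀ {b} → T b → b ≡ true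
T⇒≡true = Equivalence.to T-≡

≡true⇒T : ∀ {b} → b ≡ true → T b
≡true⇒T = Equivalence.from T-≡

T-ext : ∀ {a b} → (T a → T b) → (T b → T a) → a ≡ b
T-ext {false} {false} _ _ = refl
T-ext {false} {true}  _ g = ⊥-elim (g tt)
T-ext {true}  {false} f _ = ⊥-elim (f tt)
T-ext {true}  {true}  _ _ = refl

≡ᵇ-refl : ∀ x → (x ≡ᵇ x) ≡ true
≡ᵇ-refl zero    = refl
≡ᵇ-refl (suc x) = ≡ᵇ-refl x

≡ᵇ-sym : ∀ x y → (x ≡ᵇ y) ≡ (y ≡ᵇ x)
≡ᵇ-sym zero    zero    = refl
≡ᵇ-sym zero    (suc y) = refl
≡ᵇ-sym (suc x) zero    = refl
≡ᵇ-sym (suc x) (suc y) = ≡ᵇ-sym x y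

≢⇒≡ᵇ≡false : ∀ {x y} → x ≢ y → (x ≡ᵇ y) ≡ false
≢⇒≡ᵇ≡false {x} {y} x≢y with x ≡ᵇ y in eq
... | true  = ⊥-elim (x≢y (≡ᵇ⇒≡ x y (≡true⇒T eq)))
... | false = refl

<⇒<ᵇ≡true : ∀ {x y} → x < y → (x <ᵇ y) ≡ true
<⇒<ᵇ≡true x<y = T⇒≡true (<⇒<ᵇ x<y)

≮⇒<ᵇ≡false : ∀ {x y} → ¬ x < y → (x <ᵇ y) ≡ false
≮⇒<ᵇ≡false {x} {y} x≮y with x <ᵇ y in eq
... | true  = ⊥-elim (x≮y (<ᵇ⇒< x y (≡true⇒T eq)))
... | false = refl

-- Bounded sums

∑ : ℕ → (ℕ → ℕ) → ℕ
∑ zero    h = 0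
∑ (suc N) h = h 0 + ∑ N (h ∘ suc)

syntax ∑ N (λ x → e) = ∑[ x < N ] e

∑-cong : ∀ N {h h′ : ℕ → ℕ} → (∀ x → x < N → h x ≡ h′ x) → ∑ N h ≡ ∑ N h′
∑-cong zero    eq = refl
∑-cong (suc N) eq = cong₂ _+_ (eq 0 z<s) (∑-cong N (λ x x<N → eq (suc x) (s<s x<N)))

∑-mono-≤ : ∀ N {h h′ : ℕ → ℕ} → (∀ x → x < N → h x ≤ h′ x) → ∑ N h ≤ ∑ N h′
∑-mono-≤ zero    le = z≤n
∑-mono-≤ (suc N) le = +-mono-≤ (le 0 z<s) (∑-mono-≤ N (λ x x<N → le (suc x) (s<s x<N)))

∑-mono-< : ∀ N {h h′ : ℕ → ℕ} p → p < N → (∀ x → x < N → h x ≤ h′ x) → h p < h′ p → ∑ N h < ∑ N h′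
∑-mono-< (suc N) zero    _         le lt = +-mono-<-≤ lt (∑-mono-≤ N (λ x x<N → le (suc x) (s<s x<N)))
∑-mono-< (suc N) (suc p) (s≤s p<N) le lt =
  +-mono-≤-< (le 0 z<s) (∑-mono-< N p p<N (λ x x<N → le (suc x) (s<s x<N)) lt)

∑-zero : ∀ N → ∑[ x < N ] 0 ≡ 0
∑-zero zero    = refl
∑-zero (suc N) = ∑-zero N

∑-one : ∀ N → ∑[ x < N ] 1 ≡ N
∑-one zero    = refl
∑-one (suc N) = cong suc (∑-one N)

∑-distrib-+ : ∀ N (h h′ : ℕ → ℕ) → ∑[ x < N ] (h x + h′ x) ≡ ∑ N h + ∑ N h′
∑-distrib-+ zero    h h′ = refl
∑-distrib-+ (suc N) h h′ = begin
  (h 0 + h′ 0) + ∑[ x < N ] (h (suc x) + h′ (suc x))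
    ≡⟨ cong ((h 0 + h′ 0) +_) (∑-distrib-+ N (h ∘ suc) (h′ ∘ suc)) ⟩
  (h 0 + h′ 0) + (∑ N (h ∘ suc) + ∑ N (h′ ∘ suc))
    ≡⟨ interchange (h 0) (h′ 0) _ _ ⟩
  (h 0 + ∑ N (h ∘ suc)) + (h′ 0 + ∑ N (h′ ∘ suc)) ∎
  where open ≡-Reasoning

∑-split : ∀ A B (h : ℕ → ℕ) → ∑ (A + B) h ≡ ∑ A h + ∑[ b < B ] h (A + b)
∑-split zero    B h = refl
∑-split (suc A) B h = trans (cong (h 0 +_) (∑-split A B (h ∘ suc))) (sym (+-assoc (h 0) _ _))

∑-blocks : ∀ m s (h : ℕ → ℕ) → ∑ (m * s) h ≡ ∑[ c < m ] ∑[ a < s ] h (c * s + a)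
∑-blocks zero    s h = refl
∑-blocks (suc m) s h = begin
  ∑ (s + m * s) h                                           ≡⟨ ∑-split s (m * s) h ⟩
  ∑ s h + ∑[ b < m * s ] h (s + b)                           ≡⟨ cong (∑ s h +_) (∑-blocks m s (λ b → h (s + b))) ⟩
  ∑ s h + ∑[ c < m ] ∑[ a < s ] h (s + (c * s + a))          ≡⟨ cong (∑ s h +_) (∑-cong m (λ c _ → ∑-cong s (λ a _ →
                                                                  cong h (sym (+-assoc s (c * s) a))))) ⟩
  ∑ s h + ∑[ c < m ] ∑[ a < s ] h (suc c * s + a)            ∎
  where open ≡-Reasoning

∑-comm : ∀ A B (h : ℕ → ℕ → ℕ) → ∑[ a < A ] ∑[ b < B ] h a b ≡ ∑[ b < B ] ∑[ a < A ] h a b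
∑-comm zero    B h = sym (∑-zero B)
∑-comm (suc A) B h = begin
  ∑[ b < B ] h 0 b + ∑[ a < A ] ∑[ b < B ] h (suc a) b    ≡⟨ cong (∑[ b < B ] h 0 b +_) (∑-comm A B (h ∘ suc)) ⟩
  ∑[ b < B ] h 0 b + ∑[ b < B ] ∑[ a < A ] h (suc a) b    ≡⟨ ∑-distrib-+ B _ _ ⟨
  ∑[ b < B ] (h 0 b + ∑[ a < A ] h (suc a) b)             ∎
  where open ≡-Reasoning

term≤∑ : ∀ N (h : ℕ → ℕ) {p} → p < N → h p ≤ ∑ N h
term≤∑ (suc N) h {zero}  _         = m≤m+n (h 0) _
term≤∑ (suc N) h {suc p} (s≤s p<N) = ≤-trans (term≤∑ N (h ∘ suc) p<N) (m≤n+m _ (h 0))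

two-terms≤∑ : ∀ N (h : ℕ → ℕ) {p q} → p < N → q < N → p ≢ q → h p + h q ≤ ∑ N h
two-terms≤∑ (suc N) h {zero}  {zero}  _ _ p≢q = ⊥-elim (p≢q refl)
two-terms≤∑ (suc N) h {zero}  {suc q} _ (s≤s q<N) _ = +-monoʳ-≤ (h 0) (term≤∑ N (h ∘ suc) q<N)
two-terms≤∑ (suc N) h {suc p} {zero}  (s≤s p<N) _ _ =
  subst (_≤ ∑ (suc N) h) (+-comm (h 0) (h (suc p))) (+-monoʳ-≤ (h 0) (term≤∑ N (h ∘ suc) p<N))
two-terms≤∑ (suc N) h {suc p} {suc q} (s≤s p<N) (s≤s q<N) p≢q =
  ≤-trans (two-terms≤∑ N (h ∘ suc) p<N q<N (p≢q ∘ cong suc)) (m≤n+m _ (h 0))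

∑-supported : ∀ N (h : ℕ → ℕ) p → (∀ x → x < N → x ≢ p → h x ≡ 0) → ∑ N h ≤ h p
∑-supported zero    h p       _    = z≤n
∑-supported (suc N) h zero    vanish = ≤-reflexive (trans (cong (h 0 +_) (trans
  (∑-cong N (λ x x<N → vanish (suc x) (s<s x<N) λ ())) (∑-zero N))) (+-identityʳ (h 0)))
∑-supported (suc N) h (suc p) vanish = ≤-trans (≤-reflexive (cong (_+ ∑ N (h ∘ suc)) (vanish 0 z<s λ ())))
  (∑-supported N (h ∘ suc) p (λ x x<N x≢p → vanish (suc x) (s<s x<N) (x≢p ∘ suc-injective)))

∑-δ≤ : ∀ N p c → ∑[ x < N ] (if x ≡ᵇ p then c else 0) ≤ c
∑-δ≤ N p c = ≤-trans (∑-supported N _ p (λ x _ x≢p → cong (if_then c else 0) (≢⇒≡ᵇ≡false x≢p)))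
                     (≤-reflexive (cong (if_then c else 0) (≡ᵇ-refl p)))

∑-δ : ∀ N {p} c → p < N → ∑[ x < N ] (if x ≡ᵇ p then c else 0) ≡ c
∑-δ N {p} c p<N = ≤-antisym (∑-δ≤ N p c)
  (≤-trans (≤-reflexive (cong (if_then c else 0) (sym (≡ᵇ-refl p)))) (term≤∑ N _ p<N))

∑-two-points : ∀ N (h : ℕ → ℕ) {X Y} → X < N → Y < N → X ≢ Y →
               (∀ u → u < N → u ≢ X → u ≢ Y → 1 ≤ h u) → h X + h Y + N ≤ ∑ N h + 2
∑-two-points N h {X} {Y} X<N Y<N X≢Y others = begin
  h X + h Y + N
    ≡⟨ cong₂ (λ a b → a + b + N) (∑-δ N (h X) X<N) (∑-δ N (h Y) Y<N) ⟨
  ∑ N δX + ∑ N δY + N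
    ≡⟨ cong₂ _+_ (∑-distrib-+ N δX δY) (∑-one N) ⟨
  ∑[ u < N ] (δX u + δY u) + ∑[ u < N ] 1
    ≡⟨ ∑-distrib-+ N (λ u → δX u + δY u) (λ _ → 1) ⟨
  ∑[ u < N ] (δX u + δY u + 1)
    ≤⟨ ∑-mono-≤ N pointwise ⟩
  ∑[ u < N ] (h u + (𝟙 (u ≡ᵇ X) + 𝟙 (u ≡ᵇ Y)))
    ≡⟨ ∑-distrib-+ N h _ ⟩
  ∑ N h + ∑[ u < N ] (𝟙 (u ≡ᵇ X) + 𝟙 (u ≡ᵇ Y))
    ≡⟨ cong (∑ N h +_) (trans (∑-distrib-+ N _ _) (cong₂ _+_ (∑-δ N 1 X<N) (∑-δ N 1 Y<N))) ⟩
  ∑ N h + 2 ∎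
  where
  open ≤-Reasoning
  δX δY : ℕ → ℕ
  δX u = if u ≡ᵇ X then h X else 0
  δY u = if u ≡ᵇ Y then h Y else 0
  pointwise : ∀ u → u < N → δX u + δY u + 1 ≤ h u + (𝟙 (u ≡ᵇ X) + 𝟙 (u ≡ᵇ Y))
  pointwise u u<N with u ≟ X | u ≟ Y
  ... | yes refl | yes u≡Y = ⊥-elim (X≢Y u≡Y)
  ... | yes refl | no u≢Y rewrite ≡ᵇ-refl u | ≢⇒≡ᵇ≡false u≢Y = ≤-reflexive (cong (_+ 1) (+-identityʳ (h u)))
  ... | no u≢X | yes refl rewrite ≡ᵇ-refl u | ≢⇒≡ᵇ≡false u≢X = ≤-refl
  ... | no u≢X | no u≢Y rewrite ≢⇒≡ᵇ≡false u≢X | ≢⇒≡ᵇ≡false u≢Y =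
    ≤-trans (others u u<N u≢X u≢Y) (m≤m+n (h u) 0)

∑<N⇒zero-term : ∀ N (h : ℕ → ℕ) → ∑ N h < N → ∃ λ x → x < N × h x ≡ 0
∑<N⇒zero-term (suc N) h sum<N with h 0 in h0
... | zero  = 0 , z<s , h0
... | suc j = let x , x<N , hx≡0 = ∑<N⇒zero-term N (h ∘ suc) (<-≤-trans (m<n+m _ z<s) (≤-pred sum<N))
              in suc x , s<s x<N , hx≡0

fresh : ∀ N a b c → 3 < N → ∃ λ x → x < N × x ≢ a × x ≢ b × x ≢ c
fresh N a b c 3<N =
  let x , x<N , none = ∑<N⇒zero-term N hits (≤-<-trans count 3<N)
  in x , x<N , miss a (m+n≡0⇒m≡0 _ none) , miss b (m+n≡0⇒m≡0 _ (m+n≡0⇒n≡0 (𝟙 (x ≡ᵇ a)) none))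
       , miss c (m+n≡0⇒n≡0 _ (m+n≡0⇒n≡0 (𝟙 (x ≡ᵇ a)) none))
  where
  hits : ℕ → ℕ
  hits x = 𝟙 (x ≡ᵇ a) + (𝟙 (x ≡ᵇ b) + 𝟙 (x ≡ᵇ c))
  count : ∑ N hits ≤ 3
  count = ≤-trans (≤-reflexive (trans (∑-distrib-+ N _ _) (cong (∑ N (λ x → 𝟙 (x ≡ᵇ a)) +_) (∑-distrib-+ N _ _))))
                  (+-mono-≤ (∑-δ≤ N a 1) (+-mono-≤ (∑-δ≤ N b 1) (∑-δ≤ N c 1)))
  miss : ∀ {x} y → 𝟙 (x ≡ᵇ y) ≡ 0 → x ≢ y
  miss {x} y eq refl = subst (λ b → 𝟙 b ≢ 0) (sym (≡ᵇ-refl x)) (λ ()) eq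

-- Digraphs on {0, …, N - 1}; adjacency at vertices ≥ N is ignored

Digraph : Set
Digraph = ℕ → ℕ → Bool

Symmetric : Digraph → Set
Symmetric g = ∀ u v → g u v ≡ g v u

outdeg : ℕ → Digraph → ℕ → ℕ
outdeg N g u = ∑[ v < N ] 𝟙 (g u v)

arcs : ℕ → Digraph → ℕ
arcs N g = ∑[ u < N ] outdeg N g u

arc≤outdeg : ∀ N g {u v} → v < N → T (g u v) → 1 ≤ outdeg N g u
arc≤outdeg N g {u} v<N guv = ≤-trans (≤-reflexive (sym (𝟙-true guv))) (term≤∑ N (𝟙 ∘ g u) v<N)

two-arcs≤outdeg : ∀ N g {u v w} → v < N → w < N → v ≢ w → T (g u v) → T (g u w) → 2 ≤ outdeg N g u
two-arcs≤outdeg N g {u} v<N w<N v≢w guv guw =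
  ≤-trans (≤-reflexive (sym (cong₂ _+_ (𝟙-true guv) (𝟙-true guw)))) (two-terms≤∑ N (𝟙 ∘ g u) v<N w<N v≢w)

edge⇒2≤arcs : ∀ N g {u v} → Symmetric g → u < N → v < N → u ≢ v → T (g u v) → 2 ≤ arcs N g
edge⇒2≤arcs N g {u} {v} sym-g u<N v<N u≢v guv =
  ≤-trans (+-mono-≤ (arc≤outdeg N g v<N guv) (arc≤outdeg N g u<N (subst T (sym-g u v) guv)))
          (two-terms≤∑ N (outdeg N g) u<N v<N u≢v)

two-edges⇒3≤arcs : ∀ N g {u v w} → Symmetric g → u < N → v < N → w < N → u ≢ v → v ≢ w →
                   T (g u v) → T (g u w) → 3 ≤ arcs N g
two-edges⇒3≤arcs N g {u} {v} sym-g u<N v<N w<N u≢v v≢w guv guw =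
  ≤-trans (+-mono-≤ (two-arcs≤outdeg N g v<N w<N v≢w guv guw) (arc≤outdeg N g u<N (subst T (sym-g u v) guv)))
          (two-terms≤∑ N (outdeg N g) u<N v<N u≢v)

-- g, viewed as a set of edges of the complete graph K_N, meets every X–Y path of length ≤ 2.
separating-set-bound : ∀ N g {X Y} → Symmetric g → X < N → Y < N → X ≢ Y → T (g X Y) →
                       (∀ c → c < N → c ≢ X → c ≢ Y → T (g X c ∨ g c Y)) → N + N ≤ arcs N g + 2
separating-set-bound N g {X} {Y} sym-g X<N Y<N X≢Y gXY blocked = begin
  N + N                             ≤⟨ +-monoˡ-≤ N ends-cover ⟩
  outdeg N g X + outdeg N g Y + N   ≤⟨ ∑-two-points N (outdeg N g) X<N Y<N X≢Y inner-vertex ⟩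
  arcs N g + 2                      ∎
  where
  open ≤-Reasoning
  blocked-pair : ∀ c → c < N → c ≢ X → c ≢ Y → 1 ≤ 𝟙 (g X c) + 𝟙 (g Y c)
  blocked-pair c c<N c≢X c≢Y =
    subst (λ b → 1 ≤ 𝟙 (g X c) + 𝟙 b) (sym-g c Y) (𝟙-∨ (g X c) (g c Y) (blocked c c<N c≢X c≢Y))
  ends-cover : N ≤ outdeg N g X + outdeg N g Y
  ends-cover = begin
    N                                        ≡⟨ ∑-one N ⟨
    ∑[ v < N ] 1                             ≤⟨ ∑-mono-≤ N covered ⟩
    ∑[ v < N ] (𝟙 (g X v) + 𝟙 (g Y v))       ≡⟨ ∑-distrib-+ N _ _ ⟩
    outdeg N g X + outdeg N g Y              ∎
    where
    covered : ∀ v → v < N → 1 ≤ 𝟙 (g X v) + 𝟙 (g Y v)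
    covered v v<N with v ≟ X | v ≟ Y
    ... | yes refl | _        = ≤-trans (≤-reflexive (sym (𝟙-true (subst T (sym-g X Y) gXY)))) (m≤n+m _ _)
    ... | no _     | yes refl = ≤-trans (≤-reflexive (sym (𝟙-true gXY))) (m≤m+n _ _)
    ... | no v≢X   | no v≢Y   = blocked-pair v v<N v≢X v≢Y
  inner-vertex : ∀ u → u < N → u ≢ X → u ≢ Y → 1 ≤ outdeg N g u
  inner-vertex u u<N u≢X u≢Y = ≤-trans
    (subst₂ (λ a b → 1 ≤ 𝟙 a + 𝟙 b) (sym-g X u) (sym-g Y u) (blocked-pair u u<N u≢X u≢Y))
    (two-terms≤∑ N (𝟙 ∘ g u) X<N Y<N X≢Y)

star : Digraph → ℕ → Digraph
star A v u w = A u w ∧ ((u ≡ᵇ v) ∨ (w ≡ᵇ v))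

arcs-star : ∀ N A {v} → Symmetric A → v < N → arcs N (star A v) ≤ outdeg N A v + outdeg N A v
arcs-star N A {v} sym-A v<N = begin
  arcs N (star A v)
    ≤⟨ ∑-mono-≤ N (λ u _ → ∑-mono-≤ N (λ w _ → entry u w)) ⟩
  ∑[ u < N ] ∑[ w < N ] (from u w + into u w)
    ≡⟨ ∑-cong N (λ u _ → ∑-distrib-+ N (from u) (into u)) ⟩
  ∑[ u < N ] (∑[ w < N ] from u w + ∑[ w < N ] into u w)
    ≡⟨ ∑-distrib-+ N _ _ ⟩
  ∑[ u < N ] ∑[ w < N ] from u w + ∑[ u < N ] ∑[ w < N ] into u w
    ≡⟨ cong₂ _+_ (trans (∑-cong N (λ u _ → ∑-if u)) (∑-δ N _ v<N))
                 (∑-cong N (λ u _ → trans (∑-δ N _ v<N) (cong 𝟙 (sym-A u v)))) ⟩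
  outdeg N A v + outdeg N A v ∎
  where
  open ≤-Reasoning
  from into : ℕ → ℕ → ℕ
  from u w = if u ≡ᵇ v then 𝟙 (A v w) else 0
  into u w = if w ≡ᵇ v then 𝟙 (A u v) else 0
  ∑-if : ∀ u → ∑[ w < N ] from u w ≡ (if u ≡ᵇ v then outdeg N A v else 0)
  ∑-if u with u ≡ᵇ v
  ... | true  = refl
  ... | false = ∑-zero N
  entry : ∀ u w → 𝟙 (star A v u w) ≤ from u w + into u w
  entry u w with u ≟ v | w ≟ v
  ... | yes refl | _ rewrite ≡ᵇ-refl u = ≤-trans (𝟙-∧≤ˡ (A u w) true) (m≤m+n _ _)
  ... | no u≢v | yes refl rewrite ≢⇒≡ᵇ≡false u≢v | ≡ᵇ-refl w = 𝟙-∧≤ˡ (A u w) true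
  ... | no u≢v | no w≢v rewrite ≢⇒≡ᵇ≡false u≢v | ≢⇒≡ᵇ≡false w≢v | ∧-zeroʳ (A u w) = z≤n

data Reachable (N : ℕ) (A F : Digraph) (u : ℕ) : ℕ → Set where
  here : Reachable N A F u u
  step : ∀ {w v} → Reachable N A F u w → v < N → T (A w v) → F w v ≡ false → Reachable N A F u v

module _ {N : ℕ} {A F : Digraph} where

  Reachable-bound : ∀ {u v} → u < N → Reachable N A F u v → v < N
  Reachable-bound u<N here            = u<N
  Reachable-bound u<N (step _ v<N _ _) = v<N

  Reachable-trans : ∀ {u v w} → Reachable N A F u v → Reachable N A F v w → Reachable N A F u w
  Reachable-trans r here                 = r
  Reachable-trans r (step r′ w<N a free) = step (Reachable-trans r r′) w<N a free

  Reachable-sym : Symmetric A → Symmetric F → ∀ {u v} → u < N → Reachable N A F u v → Reachable N A F v u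
  Reachable-sym sym-A sym-F u<N here = here
  Reachable-sym sym-A sym-F u<N (step r v<N a free) =
    Reachable-trans (step here (Reachable-bound u<N r) (subst T (sym-A _ _) a) (trans (sym-F _ _) free))
                    (Reachable-sym sym-A sym-F u<N r)

-- DCell

t-pos : ∀ n k → 1 ≤ n → 1 ≤ t n k
t-pos n zero    1≤n = 1≤n
t-pos n (suc k) 1≤n = *-mono-≤ (t-pos n k 1≤n) (m≤n+m 1 (t n k))

n+k≤t : ∀ n k → 1 ≤ n → n + k ≤ t n k
n+k≤t n zero    1≤n = ≤-reflexive (+-identityʳ n)
n+k≤t n (suc k) 1≤n = begin
  n + suc k             ≡⟨ +-suc n k ⟩
  suc (n + k)           ≤⟨ s≤s (n+k≤t n k 1≤n) ⟩
  suc (t n k)           ≡⟨ +-comm 1 (t n k) ⟩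
  t n k + 1             ≡⟨ *-identityˡ _ ⟨
  1 * (t n k + 1)       ≤⟨ *-monoˡ-≤ (t n k + 1) (t-pos n k 1≤n) ⟩
  t n k * (t n k + 1)   ∎
  where open ≤-Reasoning

2≤t : ∀ n k → 2 ≤ n → 2 ≤ t n k
2≤t n k 2≤n = ≤-trans 2≤n (≤-trans (m≤m+n n k) (n+k≤t n k (<⇒≤ 2≤n)))

n+k<t : ∀ n k → 2 ≤ n → 1 ≤ k → n + k < t n k
n+k<t n (suc k) 2≤n _ = begin-strict
  n + suc k              ≡⟨ +-suc n k ⟩
  suc (n + k)            ≤⟨ s≤s (n+k≤t n k (<⇒≤ 2≤n)) ⟩
  suc (t n k)            <⟨ subst (_≤ t n k + t n k) (+-comm (t n k) 2) (+-monoʳ-≤ (t n k) (2≤t n k 2≤n)) ⟩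
  t n k + t n k          ≡⟨ cong (t n k +_) (+-identityʳ (t n k)) ⟨
  2 * t n k              ≤⟨ *-mono-≤ (2≤t n k 2≤n) (m≤m+n (t n k) 1) ⟩
  t n k * (t n k + 1)    ∎
  where open ≤-Reasoning

t-suc : ∀ n k → t n (suc k) ≡ suc (t n k) * t n k
t-suc n k = trans (*-comm (t n k) (t n k + 1)) (cong (_* t n k) (+-comm (t n k) 1))

block-coordinates : ∀ s c a → a < s → div' (c * s + a) s ≡ c × mod' (c * s + a) s ≡ a
block-coordinates (suc s) c a a<s = quotient , remainder
  where
  quotient : (c * suc s + a) / suc s ≡ c
  quotient = begin
    (c * suc s + a) / suc s         ≡⟨ cong (_/ suc s) (+-comm (c * suc s) a) ⟩
    (a + c * suc s) / suc s         ≡⟨ +-distrib-/-∣ʳ a (divides-refl c) ⟩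
    a / suc s + c * suc s / suc s   ≡⟨ cong₂ _+_ (m<n⇒m/n≡0 a<s) (m*n/n≡m c (suc s)) ⟩
    c                               ∎
    where open ≡-Reasoning
  remainder : (c * suc s + a) % suc s ≡ a
  remainder = trans (cong (_% suc s) (+-comm (c * suc s) a)) (trans ([m+kn]%n≡m%n a c (suc s)) (m<n⇒m%n≡m a<s))

adj-irrefl : ∀ n k u → adj n k u u ≡ false
adj-irrefl n zero    u rewrite ≡ᵇ-refl u = refl
adj-irrefl n (suc k) u rewrite ≡ᵇ-refl (div' u (t n k)) = adj-irrefl n k (mod' u (t n k))

adj-sym : ∀ n k → Symmetric (adj n k)
adj-sym n zero    u v = cong not (≡ᵇ-sym u v)
adj-sym n (suc k) u v with div' u (t n k) | div' v (t n k) | mod' u (t n k) | mod' v (t n k)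
... | i | j | a | b with <-cmp i j
... | tri< i<j i≢j _ rewrite ≢⇒≡ᵇ≡false i≢j | ≢⇒≡ᵇ≡false (i≢j ∘ sym) | <⇒<ᵇ≡true i<j | ≮⇒<ᵇ≡false (<⇒≯ i<j) = refl
... | tri≈ _ refl _ rewrite ≡ᵇ-refl i = adj-sym n k a b
... | tri> _ i≢j i>j rewrite ≢⇒≡ᵇ≡false i≢j | ≢⇒≡ᵇ≡false (i≢j ∘ sym) | <⇒<ᵇ≡true i>j | ≮⇒<ᵇ≡false (<⇒≯ i>j) = refl

-- D_{k+1,n} consists of the copies c < m = t_{k,n} + 1 of D_{k,n}; c * s + a is vertex a of copy c.
module Copies (n k : ℕ) (1≤n : 1 ≤ n) where

  s m N : ℕ
  s = t n k
  m = suc s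
  N = t n (suc k)

  A Aₖ : Digraph
  A  = adj n (suc k)
  Aₖ = adj n k

  1≤s : 1 ≤ s
  1≤s = t-pos n k 1≤n

  N≡m*s : N ≡ m * s
  N≡m*s = t-suc n k

  vertex< : ∀ {c a} → c < m → a < s → c * s + a < N
  vertex< {c} {a} c<m a<s = begin-strict
    c * s + a   <⟨ +-monoʳ-< (c * s) a<s ⟩
    c * s + s   ≡⟨ +-comm (c * s) s ⟩
    suc c * s   ≤⟨ *-monoˡ-≤ s c<m ⟩
    m * s       ≡⟨ N≡m*s ⟨
    N           ∎
    where open ≤-Reasoning

  coordinates : ∀ {u} → u < N → Σ ℕ λ c → Σ ℕ λ a → c < m × a < s × u ≡ c * s + a
  coordinates {u} u<N with s | 1≤s | subst (u <_) N≡m*s u<N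
  ... | suc s′ | _ | u<m*s = u / suc s′ , u % suc s′ , m<n*o⇒m/o<n u<m*s , m%n<n u (suc s′)
                           , trans (m≡m%n+[m/n]*n u (suc s′)) (+-comm (u % suc s′) _)

  -- port c d is the vertex of copy c that carries the level edge to copy d.
  port : ℕ → ℕ → ℕ
  port c d = if c <ᵇ d then d ∸ 1 else d

  port< : ∀ {c d} → c < m → d < m → c ≢ d → port c d < s
  port< {c} {suc d} c<m (s≤s d<s) c≢d with c <ᵇ suc d in lt
  ... | true  = d<s
  ... | false = ≤-trans (≤∧≢⇒< (≮⇒≥ (λ c<1+d → subst T lt (<⇒<ᵇ c<1+d))) (c≢d ∘ sym)) (≤-pred c<m)
  port< {c} {zero} _ _ _ = 1≤s

  adj-blocks : ∀ c d {a b} → a < s → b < s →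
               A (c * s + a) (d * s + b) ≡ (if c ≡ᵇ d then Aₖ a b else (a ≡ᵇ port c d) ∧ (b ≡ᵇ port d c))
  adj-blocks c d {a} {b} a<s b<s
    rewrite proj₁ (block-coordinates s c a a<s) | proj₂ (block-coordinates s c a a<s)
          | proj₁ (block-coordinates s d b b<s) | proj₂ (block-coordinates s d b b<s)
    with <-cmp c d
  ... | tri< c<d c≢d _ rewrite ≢⇒≡ᵇ≡false c≢d | <⇒<ᵇ≡true c<d | ≮⇒<ᵇ≡false (<⇒≯ c<d) = refl
  ... | tri≈ _ refl _ rewrite ≡ᵇ-refl c = refl
  ... | tri> _ c≢d c>d rewrite ≢⇒≡ᵇ≡false c≢d | <⇒<ᵇ≡true c>d | ≮⇒<ᵇ≡false (<⇒≯ c>d) = ∧-comm (b ≡ᵇ c ∸ 1) (a ≡ᵇ d)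

  adj-within : ∀ c {a b} → a < s → b < s → A (c * s + a) (c * s + b) ≡ Aₖ a b
  adj-within c {a} {b} a<s b<s =
    trans (adj-blocks c c a<s b<s) (cong (if_then Aₖ a b else ((a ≡ᵇ port c c) ∧ (b ≡ᵇ port c c))) (≡ᵇ-refl c))

  level-edge : ∀ {c d} → c < m → d < m → c ≢ d → T (A (c * s + port c d) (d * s + port d c))
  level-edge {c} {d} c<m d<m c≢d
    rewrite adj-blocks c d (port< c<m d<m c≢d) (port< d<m c<m (c≢d ∘ sym))
          | ≢⇒≡ᵇ≡false c≢d | ≡ᵇ-refl (port c d) | ≡ᵇ-refl (port d c) = tt

  level-edge-ports : ∀ {c d a b} → c ≢ d → a < s → b < s → T (A (c * s + a) (d * s + b)) →
                     a ≡ port c d × b ≡ port d c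
  level-edge-ports {c} {d} c≢d a<s b<s edge
    rewrite adj-blocks c d a<s b<s | ≢⇒≡ᵇ≡false c≢d =
    let a≡ , b≡ = Equivalence.to T-∧ edge in ≡ᵇ⇒≡ _ _ a≡ , ≡ᵇ⇒≡ _ _ b≡

  -- neighbour c a is the copy joined to vertex a of copy c by its level edge.
  neighbour : ℕ → ℕ → ℕ
  neighbour c a = if a <ᵇ c then a else suc a

  neighbour< : ∀ {c a} → c < m → a < s → neighbour c a < m
  neighbour< {c} {a} c<m a<s with a <ᵇ c
  ... | true  = ≤-trans (n≤1+n _) (s≤s a<s)
  ... | false = s≤s a<s

  neighbour≢ : ∀ c a → neighbour c a ≢ c
  neighbour≢ c a eq with a <ᵇ c in lt
  ... | true  = <-irrefl eq (<ᵇ⇒< a c (≡true⇒T lt))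
  ... | false = <-irrefl (sym eq) (s≤s (≮⇒≥ λ a<c → subst T lt (<⇒<ᵇ a<c)))

  port-neighbour : ∀ c a → port c (neighbour c a) ≡ a
  port-neighbour c a with a <ᵇ c in lt
  ... | true  rewrite ≮⇒<ᵇ≡false (<⇒≯ (<ᵇ⇒< a c (≡true⇒T lt))) = refl
  ... | false rewrite <⇒<ᵇ≡true {c} {suc a} (s≤s (≮⇒≥ λ a<c → subst T lt (<⇒<ᵇ a<c))) = refl

  neighbour-port : ∀ {c d} → c ≢ d → neighbour c (port c d) ≡ d
  neighbour-port {c} {d} c≢d with <-cmp c d
  neighbour-port {c} {suc d} c≢d | tri< (s≤s c≤d) _ _
    rewrite <⇒<ᵇ≡true {c} {suc d} (s≤s c≤d) | ≮⇒<ᵇ≡false (≤⇒≯ c≤d) = refl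
  ... | tri≈ _ c≡d _ = ⊥-elim (c≢d c≡d)
  ... | tri> _ _ c>d rewrite ≮⇒<ᵇ≡false (<⇒≯ c>d) | <⇒<ᵇ≡true c>d = refl

  neighbour-injective : ∀ c {a b} → neighbour c a ≡ neighbour c b → a ≡ b
  neighbour-injective c {a} {b} eq = trans (sym (port-neighbour c a)) (trans (cong (port c) eq) (port-neighbour c b))

  within : Digraph → ℕ → Digraph
  within F c a b = F (c * s + a) (c * s + b)

  -- The level edges of F, as a digraph on the copies.
  between : Digraph → Digraph
  between F c d = if c ≡ᵇ d then false else F (c * s + port c d) (d * s + port d c)

  between-≢ : ∀ F {c d} → c ≢ d → between F c d ≡ F (c * s + port c d) (d * s + port d c)
  between-≢ F c≢d rewrite ≢⇒≡ᵇ≡false c≢d = refl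

  between-sym : ∀ F → Symmetric F → Symmetric (between F)
  between-sym F sym-F c d rewrite ≡ᵇ-sym c d with d ≡ᵇ c
  ... | true  = refl
  ... | false = sym-F _ _

  lift-within : ∀ F {c a b} → c < m → a < s → Reachable s Aₖ (within F c) a b →
                Reachable N A F (c * s + a) (c * s + b)
  lift-within F c<m a<s here = here
  lift-within F {c} c<m a<s (step r v<s edge free) =
    step (lift-within F c<m a<s r) (vertex< c<m v<s)
         (subst T (sym (adj-within c (Reachable-bound a<s r) v<s)) edge) free

  cross : ∀ F {c d} → c < m → d < m → c ≢ d → between F c d ≡ false →
          Reachable N A F (c * s + port c d) (d * s + port d c)
  cross F c<m d<m c≢d free =
    step here (vertex< d<m (port< d<m c<m (c≢d ∘ sym))) (level-edge c<m d<m c≢d) (trans (sym (between-≢ F c≢d)) free)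

  block : Digraph → ℕ → ℕ → ℕ
  block F c d = ∑[ a < s ] ∑[ b < s ] 𝟙 (F (c * s + a) (d * s + b))

  arcs-blocks : ∀ F → arcs N F ≡ ∑[ c < m ] ∑[ d < m ] block F c d
  arcs-blocks F = begin
    arcs N F
      ≡⟨ cong (λ M → ∑[ u < M ] ∑[ v < M ] 𝟙 (F u v)) N≡m*s ⟩
    ∑[ u < m * s ] ∑[ v < m * s ] 𝟙 (F u v)
      ≡⟨ ∑-blocks m s (λ u → ∑[ v < m * s ] 𝟙 (F u v)) ⟩
    ∑[ c < m ] ∑[ a < s ] ∑[ v < m * s ] 𝟙 (F (c * s + a) v)
      ≡⟨ ∑-cong m (λ c _ → ∑-cong s (λ a _ → ∑-blocks m s (𝟙 ∘ F (c * s + a)))) ⟩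
    ∑[ c < m ] ∑[ a < s ] ∑[ d < m ] ∑[ b < s ] 𝟙 (F (c * s + a) (d * s + b))
      ≡⟨ ∑-cong m (λ c _ → ∑-comm s m (λ a d → ∑[ b < s ] 𝟙 (F (c * s + a) (d * s + b)))) ⟩
    ∑[ c < m ] ∑[ d < m ] block F c d ∎
    where open ≡-Reasoning

  row-bound : ∀ F {c} → c < m → arcs s (within F c) + outdeg m (between F) c ≤ ∑[ d < m ] block F c d
  row-bound F {c} c<m = begin
    arcs s (within F c) + outdeg m (between F) c
      ≡⟨ cong (_+ outdeg m (between F) c) (∑-δ m (block F c c) c<m) ⟨
    ∑[ d < m ] diagonal d + outdeg m (between F) c
      ≡⟨ ∑-distrib-+ m diagonal (𝟙 ∘ between F c) ⟨
    ∑[ d < m ] (diagonal d + 𝟙 (between F c d))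
      ≤⟨ ∑-mono-≤ m pointwise ⟩
    ∑[ d < m ] block F c d ∎
    where
    open ≤-Reasoning
    diagonal : ℕ → ℕ
    diagonal d = if d ≡ᵇ c then block F c c else 0
    pointwise : ∀ d → d < m → diagonal d + 𝟙 (between F c d) ≤ block F c d
    pointwise d d<m with d ≟ c
    ... | yes refl rewrite ≡ᵇ-refl d = ≤-reflexive (+-identityʳ _)
    ... | no d≢c rewrite ≢⇒≡ᵇ≡false d≢c | between-≢ F (d≢c ∘ sym) =
      ≤-trans (term≤∑ s (λ b → 𝟙 (F (c * s + port c d) (d * s + b))) (port< d<m c<m d≢c))
              (term≤∑ s (λ a → ∑[ b < s ] 𝟙 (F (c * s + a) (d * s + b))) (port< c<m d<m (d≢c ∘ sym)))

  arcs-decomposition : ∀ F → ∑[ c < m ] arcs s (within F c) + arcs m (between F) ≤ arcs N F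
  arcs-decomposition F = begin
    ∑[ c < m ] arcs s (within F c) + arcs m (between F)
      ≡⟨ ∑-distrib-+ m (λ c → arcs s (within F c)) (outdeg m (between F)) ⟨
    ∑[ c < m ] (arcs s (within F c) + outdeg m (between F) c)
      ≤⟨ ∑-mono-≤ m (λ c c<m → row-bound F c<m) ⟩
    ∑[ c < m ] ∑[ d < m ] block F c d
      ≡⟨ arcs-blocks F ⟨
    arcs N F ∎
    where open ≤-Reasoning

  between+within≤arcs : ∀ F {i} → i < m → arcs m (between F) + arcs s (within F i) ≤ arcs N F
  between+within≤arcs F {i} i<m = begin
    arcs m (between F) + arcs s (within F i)              ≤⟨ +-monoʳ-≤ (arcs m (between F))
                                                                (term≤∑ m (λ c → arcs s (within F c)) i<m) ⟩
    arcs m (between F) + ∑[ c < m ] arcs s (within F c)   ≡⟨ +-comm (arcs m (between F)) _ ⟩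
    ∑[ c < m ] arcs s (within F c) + arcs m (between F)   ≤⟨ arcs-decomposition F ⟩
    arcs N F                                              ∎
    where open ≤-Reasoning

  within+within≤arcs : ∀ F {i j} → i < m → j < m → j ≢ i → arcs s (within F j) + arcs s (within F i) ≤ arcs N F
  within+within≤arcs F {i} {j} i<m j<m j≢i = begin
    arcs s (within F j) + arcs s (within F i)             ≤⟨ two-terms≤∑ m (λ c → arcs s (within F c)) j<m i<m j≢i ⟩
    ∑[ c < m ] arcs s (within F c)                        ≤⟨ m≤m+n _ (arcs m (between F)) ⟩
    ∑[ c < m ] arcs s (within F c) + arcs m (between F)   ≤⟨ arcs-decomposition F ⟩
    arcs N F                                              ∎
    where open ≤-Reasoning

  level-degree : ∀ {c d a} → c < m → d < m → c ≢ d → a < s →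
                 ∑[ b < s ] 𝟙 (A (c * s + a) (d * s + b)) ≤ 𝟙 (d ≡ᵇ neighbour c a)
  level-degree {c} {d} {a} c<m d<m c≢d a<s =
    ≤-trans (∑-supported s _ (port d c) off-port) (𝟙-mono at-port)
    where
    off-port : ∀ b → b < s → b ≢ port d c → 𝟙 (A (c * s + a) (d * s + b)) ≡ 0
    off-port b b<s b≢port with A (c * s + a) (d * s + b) in edge
    ... | false = refl
    ... | true  = ⊥-elim (b≢port (proj₂ (level-edge-ports c≢d a<s b<s (≡true⇒T edge))))
    at-port : T (A (c * s + a) (d * s + port d c)) → T (d ≡ᵇ neighbour c a)
    at-port edge = ≡⇒≡ᵇ d _ (sym (trans (cong (neighbour c) (proj₁ (level-edge-ports c≢d a<s
                     (port< d<m c<m (c≢d ∘ sym)) edge))) (neighbour-port c≢d)))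

outdeg-adj : ∀ n k → 1 ≤ n → ∀ {v} → v < t n k → outdeg (t n k) (adj n k) v + 1 ≤ n + k
outdeg-adj n zero 1≤n {v} v<n = ≤-reflexive (begin
  outdeg n (adj n 0) v + 1                       ≡⟨ cong (outdeg n (adj n 0) v +_) (∑-δ n 1 v<n) ⟨
  outdeg n (adj n 0) v + ∑[ w < n ] 𝟙 (w ≡ᵇ v)   ≡⟨ ∑-distrib-+ n _ _ ⟨
  ∑[ w < n ] (𝟙 (not (v ≡ᵇ w)) + 𝟙 (w ≡ᵇ v))    ≡⟨ ∑-cong n (λ w _ → complement w) ⟩
  ∑[ w < n ] 1                                   ≡⟨ trans (∑-one n) (sym (+-identityʳ n)) ⟩
  n + 0                                          ∎)
  where
  open ≡-Reasoning
  complement : ∀ w → 𝟙 (not (v ≡ᵇ w)) + 𝟙 (w ≡ᵇ v) ≡ 1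
  complement w rewrite ≡ᵇ-sym w v with v ≡ᵇ w
  ... | true  = refl
  ... | false = refl
outdeg-adj n (suc k) 1≤n v<N with Copies.coordinates n k 1≤n v<N
... | c , a , c<m , a<s , refl = begin
  outdeg N A (c * s + a) + 1
    ≡⟨ cong (λ M → ∑[ u < M ] 𝟙 (A (c * s + a) u) + 1) N≡m*s ⟩
  ∑[ u < m * s ] 𝟙 (A (c * s + a) u) + 1
    ≡⟨ cong (_+ 1) (∑-blocks m s (𝟙 ∘ A (c * s + a))) ⟩
  ∑[ d < m ] ∑[ b < s ] 𝟙 (A (c * s + a) (d * s + b)) + 1
    ≤⟨ +-monoˡ-≤ 1 (∑-mono-≤ m pointwise) ⟩
  ∑[ d < m ] (own d + 𝟙 (d ≡ᵇ neighbour c a)) + 1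
    ≡⟨ cong (_+ 1) (trans (∑-distrib-+ m own (λ d → 𝟙 (d ≡ᵇ neighbour c a)))
                          (cong₂ _+_ (∑-δ m _ c<m) (∑-δ m 1 (neighbour< c<m a<s)))) ⟩
  outdeg s Aₖ a + 1 + 1
    ≤⟨ +-monoˡ-≤ 1 (outdeg-adj n k 1≤n a<s) ⟩
  n + k + 1
    ≡⟨ trans (+-assoc n k 1) (cong (n +_) (+-comm k 1)) ⟩
  n + suc k ∎
  where
  open Copies n k 1≤n
  open ≤-Reasoning
  own : ℕ → ℕ
  own d = if d ≡ᵇ c then outdeg s Aₖ a else 0
  pointwise : ∀ d → d < m → ∑[ b < s ] 𝟙 (A (c * s + a) (d * s + b)) ≤ own d + 𝟙 (d ≡ᵇ neighbour c a)
  pointwise d d<m with d ≟ c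
  ... | yes refl rewrite ≡ᵇ-refl d = ≤-trans (≤-reflexive (∑-cong s (λ b b<s → cong 𝟙 (adj-within d a<s b<s))))
                                              (m≤m+n _ _)
  ... | no d≢c rewrite ≢⇒≡ᵇ≡false d≢c = level-degree c<m d<m (d≢c ∘ sym) a<s

double-+-suc : ∀ n k → (n + suc k) + (n + suc k) ≡ (n + k) + (n + k) + 2
double-+-suc n k = trans (cong₂ _+_ (+-suc n k) (+-suc n k))
                         (trans (cong suc (+-suc (n + k) (n + k))) (+-comm 2 ((n + k) + (n + k))))

-- λ(D_{k,n}) ≥ n + k − 1, counted in arcs (each edge of G twice).
SeparationBound : ℕ → ℕ → Set
SeparationBound n k = ∀ G → Symmetric G → ∀ {x y} → x < t n k → y < t n k →
                      ¬ Reachable (t n k) (adj n k) G x y → (n + k) + (n + k) ≤ arcs (t n k) G + 2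

module Cut (n k : ℕ) (2≤n : 2 ≤ n) (boundₖ : SeparationBound n k) (F : Digraph) (sym-F : Symmetric F) where

  open Copies n k (<⇒≤ 2≤n) public
  open RawMonad (¬¬-Monad {0ℓ})

  R : ℕ → ℕ → Set
  R = Reachable N A F

  -- Reachability is never decided, so connectivity is asserted up to double negation (a monad).
  CopyConnected : ℕ → Set
  CopyConnected c = ∀ {a b} → a < s → b < s → ¬ ¬ Reachable s Aₖ (within F c) a b

  Joined : ℕ → ℕ → Set
  Joined c d = ∀ {a b} → a < s → b < s → ¬ ¬ R (c * s + a) (d * s + b)

  joined-refl : ∀ {c} → c < m → CopyConnected c → Joined c c
  joined-refl c<m connected a<s b<s = do
    r ← connected a<s b<s
    pure (lift-within F c<m a<s r)

  joined-trans : ∀ {c d e} → Joined c d → Joined d e → Joined c e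
  joined-trans c~d d~e a<s b<s = do
    r₁ ← c~d a<s 1≤s
    r₂ ← d~e 1≤s b<s
    pure (Reachable-trans r₁ r₂)

  joined-cross : ∀ {c d} → c < m → d < m → c ≢ d → CopyConnected c → CopyConnected d →
                 between F c d ≡ false → Joined c d
  joined-cross c<m d<m c≢d c-connected d-connected free a<s b<s = do
    r₁ ← joined-refl c<m c-connected a<s (port< c<m d<m c≢d)
    r₂ ← joined-refl d<m d-connected (port< d<m c<m (c≢d ∘ sym)) b<s
    pure (Reachable-trans r₁ (Reachable-trans (cross F c<m d<m c≢d free) r₂))

  separated-copies-bound : (∀ {c} → c < m → CopyConnected c) → ∀ {x y} → x < N → y < N → ¬ R x y →
                           m + m ≤ arcs m (between F) + 2
  separated-copies-bound connected x<N y<N x↛y with coordinates x<N | coordinates y<N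
  ... | X , a , X<m , a<s , refl | Y , b , Y<m , b<s , refl with X ≟ Y
  ... | yes refl = ⊥-elim (joined-refl X<m (connected X<m) a<s b<s x↛y)
  ... | no X≢Y   = separating-set-bound m (between F) (between-sym F sym-F) X<m Y<m X≢Y
                     (blocked-directly X≢Y) blocked-via
    where
    blocked-directly : X ≢ Y → T (between F X Y)
    blocked-directly X≢Y with between F X Y in free
    ... | true  = tt
    ... | false = joined-cross X<m Y<m X≢Y (connected X<m) (connected Y<m) free a<s b<s x↛y
    blocked-via : ∀ c → c < m → c ≢ X → c ≢ Y → T (between F X c ∨ between F c Y)
    blocked-via c c<m c≢X c≢Y with between F X c in free₁ | between F c Y in free₂
    ... | true  | _    = tt
    ... | false | true = tt
    ... | false | false = joined-trans {X} {c} {Y}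
                                       (joined-cross X<m c<m (c≢X ∘ sym) (connected X<m) (connected c<m) free₁)
                                       (joined-cross c<m Y<m c≢Y (connected c<m) (connected Y<m) free₂) a<s b<s x↛y

  Escapes : ℕ → ℕ → Set
  Escapes i u = ∃ λ d → ∃ λ b → d < m × b < s × d ≢ i × R u (d * s + b)

  escapes-via-level-edge : ∀ {i a} → i < m → a < s → between F i (neighbour i a) ≡ false → Escapes i (i * s + a)
  escapes-via-level-edge {i} {a} i<m a<s free =
    d , port d i , d<m , port< d<m i<m (neighbour≢ i a) , neighbour≢ i a ,
    subst (λ v → R (i * s + v) (d * s + port d i)) (port-neighbour i a) (cross F i<m d<m (neighbour≢ i a ∘ sym) free)
    where
    d = neighbour i a
    d<m = neighbour< i<m a<s

  escapes-unless-inside : ∀ {i u} → u < N → (∀ {a} → a < s → u ≡ i * s + a → ¬ ¬ Escapes i u) → ¬ ¬ Escapes i u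
  escapes-unless-inside {i} u<N inside with coordinates u<N
  ... | c , a , c<m , a<s , refl with c ≟ i
  ... | yes refl = inside a<s refl
  ... | no c≢i   = pure (c , a , c<m , a<s , c≢i , here)

  connected-through-outside : ∀ {i x y} → (∀ {c d} → c < m → d < m → c ≢ i → d ≢ i → Joined c d) →
                              y < N → ¬ ¬ Escapes i x → ¬ ¬ Escapes i y → ¬ ¬ R x y
  connected-through-outside outside-joined y<N x-escapes y-escapes = do
    c , a , c<m , a<s , c≢i , x→c ← x-escapes
    d , b , d<m , b<s , d≢i , y→d ← y-escapes
    c→d ← outside-joined c<m d<m c≢i d≢i a<s b<s
    pure (Reachable-trans x→c (Reachable-trans c→d (Reachable-sym (adj-sym n (suc k)) sym-F y<N y→d)))

  B : ℕ
  B = (n + k) + (n + k)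

  -- By the bound at level k, only heavy copies can be disconnected by F.
  Heavy : ℕ → Set
  Heavy c = B ≤ arcs s (within F c) + 2

  light-connected : ∀ {c} → ¬ Heavy c → CopyConnected c
  light-connected {c} light a<s b<s a↛b = light (boundₖ (within F c) (λ _ _ → sym-F _ _) a<s b<s a↛b)

  heavy-or-all-connected : (∃ λ i → i < m × Heavy i) ⊎ (∀ {c} → c < m → CopyConnected c)
  heavy-or-all-connected with anyUpTo? (λ c → B ≤? arcs s (within F c) + 2) m
  ... | yes heavy = inj₁ heavy
  ... | no  none  = inj₂ λ {c} c<m → light-connected {c} (λ heavy → none (c , c<m , heavy))

  all-connected-bound : (∀ {c} → c < m → CopyConnected c) → ∀ {x y} → x < N → y < N → ¬ R x y →
                        s + s ≤ arcs N F
  all-connected-bound connected x<N y<N x↛y = begin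
    s + s                                                 ≤⟨ +-cancelʳ-≤ 2 _ _ (subst (_≤ arcs m (between F) + 2)
                                                              (trans (cong suc (+-suc s s)) (+-comm 2 (s + s)))
                                                              (separated-copies-bound connected x<N y<N x↛y)) ⟩
    arcs m (between F)                                    ≤⟨ m≤n+m _ (∑[ c < m ] arcs s (within F c)) ⟩
    ∑[ c < m ] arcs s (within F c) + arcs m (between F)   ≤⟨ arcs-decomposition F ⟩
    arcs N F                                              ∎
    where open ≤-Reasoning

  -- Out of a budget arcs N F + r ≤ B, a heavy copy leaves at most 2 ∸ r arcs to the rest of the graph.
  leftover : ∀ {i x r} → Heavy i → x + arcs s (within F i) ≤ arcs N F → arcs N F + r ≤ B → x + r ≤ 2
  leftover {i} {x} {r} heavy x+Fᵢ≤ budget = +-cancelʳ-≤ B _ _ (begin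
    x + r + B                          ≤⟨ +-monoʳ-≤ (x + r) heavy ⟩
    x + r + (arcs s (within F i) + 2)  ≡⟨ interchange x r (arcs s (within F i)) 2 ⟩
    x + arcs s (within F i) + (r + 2)  ≤⟨ +-monoˡ-≤ (r + 2) x+Fᵢ≤ ⟩
    arcs N F + (r + 2)                 ≡⟨ +-assoc (arcs N F) r 2 ⟨
    arcs N F + r + 2                   ≤⟨ +-monoˡ-≤ 2 budget ⟩
    B + 2                              ≡⟨ +-comm B 2 ⟩
    2 + B                              ∎)
    where open ≤-Reasoning

  others-connected : ∀ {i r} → i < m → Heavy i → arcs N F + r ≤ B → 5 ≤ B + r →
                     ∀ {j} → j < m → j ≢ i → CopyConnected j
  others-connected {i} {r} i<m heavy budget 5≤B+r {j} j<m j≢i = light-connected {j} λ heavyⱼ →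
    <⇒≱ (s≤s (begin
      B + r                          ≤⟨ +-monoˡ-≤ r heavyⱼ ⟩
      arcs s (within F j) + 2 + r    ≡⟨ xy∙z≈xz∙y (arcs s (within F j)) 2 r ⟩
      arcs s (within F j) + r + 2    ≤⟨ +-monoˡ-≤ 2 (leftover {i} heavy (within+within≤arcs F i<m j<m j≢i) budget) ⟩
      4                              ∎)) 5≤B+r
    where open ≤-Reasoning

  sparse-cut-connects : arcs N F < B → ∀ {x y} → x < N → y < N → ¬ ¬ R x y
  sparse-cut-connects sparse x<N y<N with heavy-or-all-connected
  ... | inj₂ connected = λ x↛y → <⇒≱ sparse (≤-trans B≤s+s (all-connected-bound connected x<N y<N x↛y))
    where
    B≤s+s : B ≤ s + s
    B≤s+s = +-mono-≤ (n+k≤t n k (<⇒≤ 2≤n)) (n+k≤t n k (<⇒≤ 2≤n))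
  ... | inj₁ (i , i<m , heavy) = connected-through-outside outside y<N (escapes x<N) (escapes y<N)
    where
    budget : arcs N F + 1 ≤ B
    budget = subst (_≤ B) (+-comm 1 (arcs N F)) sparse
    no-level-cut : ∀ {c d} → c < m → d < m → c ≢ d → between F c d ≡ false
    no-level-cut {c} {d} c<m d<m c≢d with between F c d in cut
    ... | false = refl
    ... | true  = ⊥-elim (<-irrefl refl (≤-trans
      (+-monoˡ-≤ 1 (edge⇒2≤arcs m (between F) (between-sym F sym-F) c<m d<m c≢d (≡true⇒T cut)))
      (leftover {i} heavy (between+within≤arcs F i<m) budget)))
    4≤B : 4 ≤ B
    4≤B = +-mono-≤ (≤-trans 2≤n (m≤m+n n k)) (≤-trans 2≤n (m≤m+n n k))
    connected : ∀ {j} → j < m → j ≢ i → CopyConnected j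
    connected = others-connected i<m heavy budget (+-monoˡ-≤ 1 4≤B)
    outside : ∀ {c d} → c < m → d < m → c ≢ i → d ≢ i → Joined c d
    outside {c} {d} c<m d<m c≢i d≢i with c ≟ d
    ... | yes refl = joined-refl c<m (connected c<m c≢i)
    ... | no c≢d   = joined-cross c<m d<m c≢d (connected c<m c≢i) (connected d<m d≢i) (no-level-cut c<m d<m c≢d)
    escapes : ∀ {u} → u < N → ¬ ¬ Escapes i u
    escapes u<N = escapes-unless-inside u<N λ {a} a<s u≡ → subst (λ v → ¬ ¬ Escapes i v) (sym u≡)
      (pure (escapes-via-level-edge i<m a<s (no-level-cut i<m (neighbour< i<m a<s) (neighbour≢ i a ∘ sym))))

  FreeEdge : ℕ → ℕ → Set
  FreeEdge x u = T (A x u) × F x u ≡ false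

  module HeavyCopy (1≤k : 1 ≤ k) (small : arcs N F ≤ B) {i} (i<m : i < m) (heavy : Heavy i) where

    budget : arcs N F + 0 ≤ B
    budget = subst (_≤ B) (sym (+-identityʳ _)) small

    3≤n+k : 3 ≤ n + k
    3≤n+k = +-mono-≤ 2≤n 1≤k

    connected : ∀ {j} → j < m → j ≢ i → CopyConnected j
    connected = others-connected i<m heavy budget (≤-trans (≤-trans (n≤1+n 5) (+-mono-≤ 3≤n+k 3≤n+k)) (m≤m+n B 0))

    no-two-level-cuts : ∀ {c d e} → c < m → d < m → e < m → c ≢ d → d ≢ e →
                    T (between F c d) → T (between F c e) → ⊥
    no-two-level-cuts c<m d<m e<m c≢d d≢e cut₁ cut₂ = <-irrefl refl (≤-trans
      (two-edges⇒3≤arcs m (between F) (between-sym F sym-F) c<m d<m e<m c≢d d≢e cut₁ cut₂)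
      (subst (_≤ 2) (+-identityʳ _) (leftover {i} heavy (between+within≤arcs F i<m) budget)))

    -- If the level edge between c and d is in F, a third copy e offers a detour.
    outside-joined : ∀ {c d} → c < m → d < m → c ≢ i → d ≢ i → Joined c d
    outside-joined {c} {d} c<m d<m c≢i d≢i with c ≟ d
    ... | yes refl = joined-refl c<m (connected c<m c≢i)
    ... | no c≢d with between F c d in cut
    ...   | false = joined-cross c<m d<m c≢d (connected c<m c≢i) (connected d<m d≢i) cut
    ...   | true  = detour (fresh m i c d (s≤s (≤-trans 3≤n+k (<⇒≤ (n+k<t n k 2≤n 1≤k)))))
      where
      detour : (∃ λ e → e < m × e ≢ i × e ≢ c × e ≢ d) → Joined c d
      detour (e , e<m , e≢i , e≢c , e≢d) = joined-trans {c} {e} {d}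
        (joined-cross c<m e<m (e≢c ∘ sym) (connected c<m c≢i) (connected e<m e≢i) free-ce)
        (joined-cross e<m d<m e≢d (connected e<m e≢i) (connected d<m d≢i) free-ed)
        where
        free-ce : between F c e ≡ false
        free-ce with between F c e in cut′
        ... | false = refl
        ... | true  = ⊥-elim (no-two-level-cuts c<m d<m e<m c≢d (e≢d ∘ sym) (≡true⇒T cut) (≡true⇒T cut′))
        free-ed : between F e d ≡ false
        free-ed with between F e d in cut′
        ... | false = refl
        ... | true  = ⊥-elim (no-two-level-cuts d<m c<m e<m (c≢d ∘ sym) (e≢c ∘ sym)
                        (≡true⇒T (trans (between-sym F sym-F d c) cut))
                        (≡true⇒T (trans (between-sym F sym-F d e) cut′)))

    blocked-level-edge : ∀ {a} → a < s → ¬ Escapes i (i * s + a) → T (between F i (neighbour i a))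
    blocked-level-edge {a} a<s trapped with between F i (neighbour i a) in cut
    ... | true  = tt
    ... | false = trapped (escapes-via-level-edge i<m a<s cut)

    -- Two trapped neighbours inside copy i would need two level edges of copy i in F.
    vertex-escapes : ∀ {a w} → a < s → w < N → FreeEdge (i * s + a) w → ¬ ¬ Escapes i (i * s + a)
    vertex-escapes {a} a<s w<N (edge , free) trapped-a with coordinates w<N
    ... | d , b , d<m , b<s , refl with d ≟ i
    ... | no d≢i   = trapped-a (d , b , d<m , b<s , d≢i , step here w<N edge free)
    ... | yes refl = no-two-level-cuts i<m (neighbour< i<m a<s) (neighbour< i<m b<s) (neighbour≢ i a ∘ sym)
                       (a≢b ∘ neighbour-injective i)
                       (blocked-level-edge a<s trapped-a) (blocked-level-edge b<s trapped-b)
      where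
      a≢b : a ≢ b
      a≢b refl = subst T (adj-irrefl n (suc k) (i * s + a)) edge
      trapped-b : ¬ Escapes i (i * s + b)
      trapped-b (d′ , b′ , d′<m , b′<s , d′≢i , r) =
        trapped-a (d′ , b′ , d′<m , b′<s , d′≢i , Reachable-trans (step here w<N edge free) r)

    escapes : ∀ {u} → u < N → (∃ λ w → w < N × FreeEdge u w) → ¬ ¬ Escapes i u
    escapes u<N (w , w<N , free) = escapes-unless-inside u<N λ a<s u≡ →
      subst (λ v → ¬ ¬ Escapes i v) (sym u≡) (vertex-escapes a<s w<N (subst (λ v → FreeEdge v w) u≡ free))

  free-edges-connect : 1 ≤ k → arcs N F ≤ B → ∀ {x y} → x < N → y < N →
                       (∃ λ u → u < N × FreeEdge x u) → (∃ λ u → u < N × FreeEdge y u) → ¬ ¬ R x y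
  free-edges-connect 1≤k small x<N y<N free-x free-y with heavy-or-all-connected
  ... | inj₂ connected = λ x↛y → <⇒≱ (≤-<-trans small B<s+s) (all-connected-bound connected x<N y<N x↛y)
    where
    B<s+s : B < s + s
    B<s+s = +-mono-< (n+k<t n k 2≤n 1≤k) (n+k<t n k 2≤n 1≤k)
  ... | inj₁ (i , i<m , heavy) =
    connected-through-outside outside-joined y<N (escapes x<N free-x) (escapes y<N free-y)
    where open HeavyCopy 1≤k small i<m heavy

  free-edge? : ∀ x u → Dec (FreeEdge x u)
  free-edge? x u = T? (A x u) ×-dec (F x u Bool.≟ false)

  no-free-edge⇒star-in-cut : ∀ {w} → ¬ (∃ λ u → u < N × FreeEdge w u) → ∀ {u} → u < N → T (A w u) → T (F w u)
  no-free-edge⇒star-in-cut {w} none {u} u<N edge with F w u in cut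
  ... | true  = tt
  ... | false = none (u , u<N , edge , cut)

  star-in-cut : 1 ≤ k → arcs N F ≤ B → ∀ {x y} → x < N → y < N → ¬ R x y →
                ∃ λ w → w < N × (∀ {u} → u < N → T (A w u) → T (F w u))
  star-in-cut 1≤k small {x} {y} x<N y<N x↛y with anyUpTo? (free-edge? x) N | anyUpTo? (free-edge? y) N
  ... | no none    | _          = x , x<N , no-free-edge⇒star-in-cut none
  ... | yes _      | no none    = y , y<N , no-free-edge⇒star-in-cut none
  ... | yes free-x | yes free-y = ⊥-elim (free-edges-connect 1≤k small x<N y<N free-x free-y x↛y)

separation-bound : ∀ n k → 2 ≤ n → SeparationBound n k
separation-bound n zero 2≤n G sym-G {x} {y} x<n y<n x↛y with x ≟ y
... | yes refl = ⊥-elim (x↛y here)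
... | no x≢y   = subst (λ l → l + l ≤ arcs n G + 2) (sym (+-identityʳ n))
                   (separating-set-bound n G sym-G x<n y<n x≢y cut-xy cut-via)
  where
  edge : ∀ {u v} → u ≢ v → T (adj n 0 u v)
  edge u≢v rewrite ≢⇒≡ᵇ≡false u≢v = tt
  cut-xy : T (G x y)
  cut-xy with G x y in cut
  ... | true  = tt
  ... | false = x↛y (step here y<n (edge x≢y) cut)
  cut-via : ∀ c → c < n → c ≢ x → c ≢ y → T (G x c ∨ G c y)
  cut-via c c<n c≢x c≢y with G x c in cut₁ | G c y in cut₂
  ... | true  | _     = tt
  ... | false | true  = tt
  ... | false | false = x↛y (step (step here c<n (edge (c≢x ∘ sym)) cut₁) y<n (edge c≢y) cut₂)
separation-bound n (suc k) 2≤n G sym-G x<N y<N x↛y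
  with (n + suc k) + (n + suc k) ≤? arcs (t n (suc k)) G + 2
... | yes enough = enough
... | no  short  = ⊥-elim (Cut.sparse-cut-connects n k 2≤n (separation-bound n k 2≤n) G sym-G sparse x<N y<N x↛y)
  where
  sparse : arcs (t n (suc k)) G < (n + k) + (n + k)
  sparse = +-cancelʳ-< 2 _ _ (subst (arcs (t n (suc k)) G + 2 <_) (double-+-suc n k) (≰⇒> short))

-- Edge sets on Fin N as digraphs on ℕ

toFin? : (N u : ℕ) → Maybe (Fin N)
toFin? zero    u       = nothing
toFin? (suc N) zero    = just fzero
toFin? (suc N) (suc u) = Maybe.map fsuc (toFin? N u)

toFin?-toℕ : ∀ {N} (x : Fin N) → toFin? N (toℕ x) ≡ just x
toFin?-toℕ {suc N} fzero    = refl
toFin?-toℕ {suc N} (fsuc x) rewrite toFin?-toℕ x = refl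

toFin?-< : ∀ {N u} (u<N : u < N) → toFin? N u ≡ just (fromℕ< u<N)
toFin?-< {N} u<N = trans (cong (toFin? N) (sym (toℕ-fromℕ< u<N))) (toFin?-toℕ (fromℕ< u<N))

sum-allFin : ∀ N (h : Fin N → ℕ) → sum (map h (allFin N)) ≡ ∑[ u < N ] maybe h 0 (toFin? N u)
sum-allFin N h = trans (cong sum (map-tabulate id h)) (sum-tabulate N h)
  where
  sum-tabulate : ∀ N (h : Fin N → ℕ) → sum (tabulate h) ≡ ∑[ u < N ] maybe h 0 (toFin? N u)
  sum-tabulate zero    h = refl
  sum-tabulate (suc N) h = cong (h fzero +_) (trans (sum-tabulate N (h ∘ fsuc))
    (∑-cong N (λ u _ → sym (maybe-map (toFin? N u)))))
    where
    maybe-map : ∀ (x : Maybe (Fin N)) → maybe h 0 (Maybe.map fsuc x) ≡ maybe (h ∘ fsuc) 0 x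
    maybe-map nothing  = refl
    maybe-map (just x) = refl

extend : ∀ {N} → (Fin N → Fin N → Bool) → Digraph
extend {N} G u v = maybe (λ a → maybe (G a) false (toFin? N v)) false (toFin? N u)

extend-toℕ : ∀ {N} (G : Fin N → Fin N → Bool) x y → extend G (toℕ x) (toℕ y) ≡ G x y
extend-toℕ G x y rewrite toFin?-toℕ x | toFin?-toℕ y = refl

extend-< : ∀ {N} (G : Fin N → Fin N → Bool) {u v} (u<N : u < N) (v<N : v < N) →
           extend G u v ≡ G (fromℕ< u<N) (fromℕ< v<N)
extend-< G u<N v<N rewrite toFin?-< u<N | toFin?-< v<N = refl

extend-sym : ∀ {N} (G : Fin N → Fin N → Bool) → (∀ a b → G a b ≡ G b a) → Symmetric (extend G)
extend-sym {N} G sym-G u v with toFin? N u | toFin? N v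
... | just a  | just b  = sym-G a b
... | just a  | nothing = refl
... | nothing | just b  = refl
... | nothing | nothing = refl

extend-irrefl : ∀ {N} (G : Fin N → Fin N → Bool) → (∀ a → G a a ≡ false) → ∀ u → extend G u u ≡ false
extend-irrefl {N} G irrefl-G u with toFin? N u
... | just a  = irrefl-G a
... | nothing = refl

edges : ℕ → Digraph → ℕ
edges N g = ∑[ u < N ] ∑[ v < N ] 𝟙 ((u <ᵇ v) ∧ g u v)

arcs≡edges+edges : ∀ N g → Symmetric g → (∀ u → g u u ≡ false) → arcs N g ≡ edges N g + edges N g
arcs≡edges+edges N g sym-g irrefl-g = begin
  arcs N g
    ≡⟨ ∑-cong N (λ u _ → trans (∑-cong N (λ v _ → split u v)) (∑-distrib-+ N _ _)) ⟩
  ∑[ u < N ] (∑[ v < N ] 𝟙 ((u <ᵇ v) ∧ g u v) + ∑[ v < N ] 𝟙 ((v <ᵇ u) ∧ g u v))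
    ≡⟨ ∑-distrib-+ N _ _ ⟩
  edges N g + ∑[ u < N ] ∑[ v < N ] 𝟙 ((v <ᵇ u) ∧ g u v)
    ≡⟨ cong (edges N g +_) (∑-comm N N (λ u v → 𝟙 ((v <ᵇ u) ∧ g u v))) ⟩
  edges N g + ∑[ v < N ] ∑[ u < N ] 𝟙 ((v <ᵇ u) ∧ g u v)
    ≡⟨ cong (edges N g +_) (∑-cong N (λ v _ → ∑-cong N (λ u _ → cong (λ b → 𝟙 ((v <ᵇ u) ∧ b)) (sym-g u v)))) ⟩
  edges N g + edges N g ∎
  where
  open ≡-Reasoning
  split : ∀ u v → 𝟙 (g u v) ≡ 𝟙 ((u <ᵇ v) ∧ g u v) + 𝟙 ((v <ᵇ u) ∧ g u v)
  split u v with <-cmp u v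
  ... | tri< u<v _ u≯v rewrite <⇒<ᵇ≡true u<v | ≮⇒<ᵇ≡false u≯v = sym (+-identityʳ _)
  ... | tri≈ _ refl _  rewrite irrefl-g u | ∧-zeroʳ (u <ᵇ u) = refl
  ... | tri> u≮v _ u>v rewrite <⇒<ᵇ≡true u>v | ≮⇒<ᵇ≡false u≮v = refl

size≡edges : ∀ n k (G : EdgeSet n k) → size n k G ≡ edges (t n k) (extend G)
size≡edges n k G = trans (sum-allFin N _) (∑-cong N row)
  where
  N = t n k
  entry : ∀ {u v} (u<N : u < N) (v<N : v < N) →
          𝟙 ((toℕ (fromℕ< u<N) <ᵇ toℕ (fromℕ< v<N)) ∧ G (fromℕ< u<N) (fromℕ< v<N)) ≡ 𝟙 ((u <ᵇ v) ∧ extend G u v)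
  entry u<N v<N rewrite extend-< G u<N v<N | toℕ-fromℕ< u<N | toℕ-fromℕ< v<N = refl
  row : ∀ u → u < N →
        maybe (λ x → sum (map (λ y → 𝟙 ((toℕ x <ᵇ toℕ y) ∧ G x y)) (allFin N))) 0 (toFin? N u)
        ≡ ∑[ v < N ] 𝟙 ((u <ᵇ v) ∧ extend G u v)
  row u u<N = trans (cong (maybe _ 0) (toFin?-< u<N)) (trans (sum-allFin N _)
    (∑-cong N λ v v<N → trans (cong (maybe _ 0) (toFin?-< v<N)) (entry u<N v<N)))

module EdgeSets (n K : ℕ) where

  N : ℕ
  N = t n K

  -- The edges at v, exactly as in SuperLambda.
  Star : Fin N → EdgeSet n K
  Star v a b = star (adj n K) (toℕ v) (toℕ a) (toℕ b)

  Symmetricᶠ : EdgeSet n K → Set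
  Symmetricᶠ G = ∀ a b → G a b ≡ G b a

  _⊆_ : EdgeSet n K → EdgeSet n K → Set
  G ⊆ H = ∀ a b → T (G a b) → T (H a b)

  ⊆Adj⇒irrefl : ∀ {G} → G ⊆ Adj n K → ∀ a → G a a ≡ false
  ⊆Adj⇒irrefl {G} G⊆A a with G a a in loop
  ... | false = refl
  ... | true  = ⊥-elim (subst T (adj-irrefl n K (toℕ a)) (G⊆A a a (≡true⇒T loop)))

  arcs≡size+size : ∀ G → Symmetricᶠ G → G ⊆ Adj n K → arcs N (extend G) ≡ size n K G + size n K G
  arcs≡size+size G sym-G G⊆A = trans (arcs≡edges+edges N _ (extend-sym G sym-G) (extend-irrefl G (⊆Adj⇒irrefl G⊆A)))
                                     (cong (λ z → z + z) (sym (size≡edges n K G)))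

  size-< : ∀ {G H} → Symmetricᶠ G → Symmetricᶠ H → G ⊆ H → H ⊆ Adj n K →
           ∀ a b → T (H a b) → G a b ≡ false → size n K G < size n K H
  size-< {G} {H} sym-G sym-H G⊆H H⊆A a b Hab Gab = ≰⇒> λ H≤G → <⇒≱ arcs-< (begin
    arcs N (extend H)              ≡⟨ arcs≡size+size H sym-H H⊆A ⟩
    size n K H + size n K H        ≤⟨ +-mono-≤ H≤G H≤G ⟩
    size n K G + size n K G        ≡⟨ arcs≡size+size G sym-G (λ a b → H⊆A a b ∘ G⊆H a b) ⟨
    arcs N (extend G)              ∎)
    where
    open ≤-Reasoning
    entry : ∀ u v → u < N → v < N → 𝟙 (extend G u v) ≤ 𝟙 (extend H u v)
    entry u v u<N v<N rewrite extend-< G u<N v<N | extend-< H u<N v<N = 𝟙-mono (G⊆H _ _)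
    at-ab : 𝟙 (extend G (toℕ a) (toℕ b)) < 𝟙 (extend H (toℕ a) (toℕ b))
    at-ab rewrite extend-toℕ G a b | extend-toℕ H a b | Gab | T⇒≡true Hab = s≤s z≤n
    arcs-< : arcs N (extend G) < arcs N (extend H)
    arcs-< = ∑-mono-< N (toℕ a) (toℕ<n a) (λ u u<N → ∑-mono-≤ N (λ v → entry u v u<N))
               (∑-mono-< N (toℕ b) (toℕ<n b) (λ v → entry (toℕ a) v (toℕ<n a)) at-ab)

  reach-fin : ∀ F {x u} → Reachable N (adj n K) (extend F) (toℕ x) u → ∀ y → toℕ y ≡ u → Reach n K F x y
  reach-fin F here y y≡x rewrite toℕ-injective y≡x = here
  reach-fin F {x} (step r _ edge free) y refl = step (reach-fin F r w (toℕ-fromℕ< w<N)) edge′ free′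
    where
    w<N = Reachable-bound (toℕ<n x) r
    w = fromℕ< w<N
    edge′ : T (Adj n K w y)
    edge′ = subst (λ z → T (adj n K z (toℕ y))) (sym (toℕ-fromℕ< w<N)) edge
    free′ : F w y ≡ false
    free′ = trans (sym (extend-toℕ F w y)) (trans (cong (λ z → extend F z (toℕ y)) (toℕ-fromℕ< w<N)) free)

  Star-sym : ∀ v → Symmetricᶠ (Star v)
  Star-sym v a b = cong₂ _∧_ (adj-sym n K (toℕ a) (toℕ b)) (∨-comm (toℕ a ≡ᵇ toℕ v) (toℕ b ≡ᵇ toℕ v))

  Star⊆Adj : ∀ v → Star v ⊆ Adj n K
  Star⊆Adj v a b e = proj₁ (Equivalence.to T-∧ e)

  Star-isolates : ∀ v {z} → Reach n K (Star v) v z → toℕ z ≡ toℕ v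
  Star-isolates v here = refl
  Star-isolates v (step {w} {y} r edge free) with () ← trans (sym (cong₂ (λ p q → p ∧ (q ∨ (toℕ y ≡ᵇ toℕ v)))
    (T⇒≡true edge) (trans (cong (_≡ᵇ toℕ v) (Star-isolates v r)) (≡ᵇ-refl (toℕ v))))) free

  Star-cut : 2 ≤ N → ∀ v → IsEdgeCut n K (Star v)
  Star-cut 2≤N v = (Star-sym v , Star⊆Adj v) , v , fromℕ< o<N ,
                   λ r → o≢v (trans (sym (toℕ-fromℕ< o<N)) (Star-isolates v r))
    where
    o : ℕ
    o = if toℕ v ≡ᵇ 0 then 1 else 0
    o<N : o < N
    o<N with toℕ v ≡ᵇ 0
    ... | true  = 2≤N
    ... | false = ≤-trans (s≤s z≤n) 2≤N
    o≢v : o ≢ toℕ v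
    o≢v with toℕ v ≡ᵇ 0 in v≡0
    ... | true  = λ 1≡v → 1+n≢0 (trans 1≡v (≡ᵇ⇒≡ (toℕ v) 0 (≡true⇒T v≡0)))
    ... | false = λ 0≡v → subst T v≡0 (≡⇒≡ᵇ (toℕ v) 0 (sym 0≡v))

  size-Star : 1 ≤ n → ∀ v → size n K (Star v) + 1 ≤ n + K
  size-Star 1≤n v = ≤-trans (+-monoˡ-≤ 1 (half (begin
    size n K (Star v) + size n K (Star v)            ≡⟨ arcs≡size+size (Star v) (Star-sym v) (Star⊆Adj v) ⟨
    arcs N (extend (Star v))                         ≡⟨ ∑-cong N (λ u u<N → ∑-cong N (λ w w<N →
                                                          cong 𝟙 (entry u<N w<N))) ⟩
    arcs N (star (adj n K) (toℕ v))                  ≤⟨ arcs-star N (adj n K) (adj-sym n K) (toℕ<n v) ⟩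
    outdeg N (adj n K) (toℕ v) + outdeg N (adj n K) (toℕ v) ∎)))
    (outdeg-adj n K 1≤n (toℕ<n v))
    where
    open ≤-Reasoning
    half : ∀ {a b} → a + a ≤ b + b → a ≤ b
    half {a} {b} a+a≤b+b = ≮⇒≥ λ b<a → <⇒≱ (+-mono-< b<a b<a) a+a≤b+b
    entry : ∀ {u w} (u<N : u < N) (w<N : w < N) → extend (Star v) u w ≡ star (adj n K) (toℕ v) u w
    entry u<N w<N rewrite extend-< (Star v) u<N w<N | toℕ-fromℕ< u<N | toℕ-fromℕ< w<N = refl

  minimal-cut-is-star : ∀ F → IsMinEdgeCut n K F → 2 ≤ N → ∀ v → (∀ b → T (Adj n K v b) → T (F v b)) →
                        ∀ a b → F a b ≡ Star v a b
  minimal-cut-is-star F (((sym-F , F⊆A) , _) , minimal) 2≤N v around-v a b = T-ext (F⊆Star a b) (Star⊆F a b)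
    where
    Star⊆F : Star v ⊆ F
    Star⊆F a b e with toℕ a ≟ toℕ v | toℕ b ≟ toℕ v
    ... | yes a≡v | _ rewrite toℕ-injective a≡v = around-v b (Star⊆Adj v v b e)
    ... | no _ | yes b≡v rewrite toℕ-injective b≡v =
      subst T (sym-F v a) (around-v a (subst T (adj-sym n K (toℕ a) (toℕ v)) (Star⊆Adj v a v e)))
    ... | no a≢v | no b≢v rewrite ≢⇒≡ᵇ≡false a≢v | ≢⇒≡ᵇ≡false b≢v | ∧-zeroʳ (adj n K (toℕ a) (toℕ b)) = ⊥-elim e
    F⊆Star : F ⊆ Star v
    F⊆Star a b Fab with Star v a b in e
    ... | true  = tt
    ... | false = <⇒≱ (size-< (Star-sym v) sym-F Star⊆F F⊆A a b Fab e) (minimal (Star v) (Star-cut 2≤N v))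

  arcs-minimal-cut : ∀ {F} → 1 ≤ n → 2 ≤ N → IsMinEdgeCut n K F → arcs N (extend F) + 2 ≤ (n + K) + (n + K)
  arcs-minimal-cut {F} 1≤n 2≤N (((sym-F , F⊆A) , _) , minimal) = begin
    arcs N (extend F) + 2                           ≡⟨ cong (_+ 2) (arcs≡size+size F sym-F F⊆A) ⟩
    size n K F + size n K F + 2                     ≤⟨ +-monoˡ-≤ 2 (+-mono-≤ (minimal _ star-cut)
                                                                             (minimal _ star-cut)) ⟩
    size n K (Star v₀) + size n K (Star v₀) + 2     ≡⟨ interchange (size n K (Star v₀)) (size n K (Star v₀)) 1 1 ⟩
    (size n K (Star v₀) + 1) + (size n K (Star v₀) + 1) ≤⟨ +-mono-≤ (size-Star 1≤n v₀) (size-Star 1≤n v₀) ⟩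
    (n + K) + (n + K)                               ∎
    where
    open ≤-Reasoning
    v₀ : Fin N
    v₀ = fromℕ< (≤-trans (s≤s z≤n) 2≤N)
    star-cut : IsEdgeCut n K (Star v₀)
    star-cut = Star-cut 2≤N v₀

  star-from-ℕ : ∀ F {w} (w<N : w < N) → (∀ {u} → u < N → T (adj n K w u) → T (extend F w u)) →
                ∀ b → T (Adj n K (fromℕ< w<N) b) → T (F (fromℕ< w<N) b)
  star-from-ℕ F w<N around b edge = subst T (extend-toℕ F _ b)
    (subst (λ z → T (extend F z (toℕ b))) (sym (toℕ-fromℕ< w<N))
      (around (toℕ<n b) (subst (λ z → T (adj n K z (toℕ b))) (toℕ-fromℕ< w<N) edge)))

theorem3 : (k n : ℕ) → 2 ≤ k → 2 ≤ n → SuperLambda n k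
theorem3 (suc k) n (s≤s 1≤k) 2≤n F min-cut@(((sym-F , _) , x , y , x↛y) , _) =
  let w , w<N , around-w = star-in-cut 1≤k small (toℕ<n x) (toℕ<n y) (λ r → x↛y (reach-fin F r y refl))
  in fromℕ< w<N , minimal-cut-is-star F min-cut 2≤N (fromℕ< w<N) (star-from-ℕ F w<N around-w)
  where
  open EdgeSets n (suc k)
  open Cut n k 2≤n (separation-bound n k 2≤n) (extend F) (extend-sym F sym-F) using (B; star-in-cut)
  2≤N : 2 ≤ N
  2≤N = 2≤t n (suc k) 2≤n
  small : arcs N (extend F) ≤ B
  small = +-cancelʳ-≤ 2 _ _ (subst (arcs N (extend F) + 2 ≤_) (double-+-suc n k)
            (arcs-minimal-cut (<⇒≤ 2≤n) 2≤N min-cut))
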